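{- Let $c \geq 4$ and let $G_1, G_2, \ldots, G_c$ be directed graphs on a common set of $n$ vertices. If $\sum_{i = 1}^c e(G_i) > \frac{c}{2}n^2$, then there exists a rainbow transitive triangle.
   Context: A directed graph $G$ consists of a vertex set $V(G)$ and an edge set $E(G)$ of ordered pairs of distinct vertices (no loops, no multiple edges; both $(u,v)$ and $(v,u)$ may be present). $e(G)=|E(G)|$. The edges of $G_i$ are thought of as having color $i$. A rainbow transitive triangle is a triple of distinct vertices $u,v,w$ together with pairwise distinct colors $a,b,d$ such that $(u,v)\in E(G_a)$, $(v,w)\in E(G_b)$, $(u,w)\in E(G_d)$. -}

module Defs where

open import Data.Nat using (ℕ; _+_; _*_; _^_; _>_; _≥_)
open import Data.Bool using (Bool; true; false)
open import Data.Fin using (Fin)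
open import Data.List using (List; map; allFin)
open import Data.Nat.ListAction using (sum)
open import Data.Product using (Σ; _×_; ∃-syntax)
open import Relation.Binary.PropositionalEquality using (_≡_; _≢_)

record Digraph (n : ℕ) : Set where
  field
    adj      : Fin n → Fin n → Bool
    loopless : ∀ v → adj v v ≡ false
open Digraph public

Edge : ∀ {n} → Digraph n → Fin n → Fin n → Set
Edge G u v = adj G u v ≡ true

count : Bool → ℕ
count true  = 1
count false = 0

e : ∀ {n} → Digraph n → ℕ
e {n} G = sum (map (λ u → sum (map (λ v → count (adj G u v)) (allFin n))) (allFin n))

sumFin : ∀ c → (Fin c → ℕ) → ℕ
sumFin c f = sum (map f (allFin c))

RainbowTransitiveTriangle : ∀ {c n} → (Fin c → Digraph n) → Set
RainbowTransitiveTriangle {c} {n} G =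
  ∃[ u ] ∃[ v ] ∃[ w ] ∃[ a ] ∃[ b ] ∃[ d ]
    ( (u ≢ v) × (v ≢ w) × (u ≢ w)
    × (a ≢ b) × (b ≢ d) × (a ≢ d)
    × Edge (G a) u v × Edge (G b) v w × Edge (G d) u w )

-- Let W(u, v) be the number of colours on the arc u → v plus the number on v → u, so that
-- W ≤ 2c and ∑ W = 2 ∑ e(Gᵢ). Without a rainbow transitive triangle, every triple with
-- side weights a, b, d satisfies ab + ad + bd ≤ c(a + b + d). If a side is empty this follows
-- from a, b, d ≤ 2c. Otherwise a + b + d ≤ 3c: the six arc colour sets split into the three
-- out-stars of the triangle, and if the out-star at x carries more than c colours then,
-- since c ≥ 4, greedily chosen distinct representatives give a rainbow triangle unless the
-- side yz carries at most 2 colours and both stars at x carry at most c + 1.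
-- Summing over all ordered triples turns the left side into 3 ∑ₓ deg(x)² and the right side
-- into 3cn ∑ W; Cauchy–Schwarz, (∑ W)² ≤ n ∑ₓ deg(x)², then gives ∑ W ≤ cn².
module Submission where

open import Defs
open import Data.Nat using (ℕ; zero; suc; _+_; _*_; _^_; _≤_; _<_; _>_; _≥_; z≤n; _≤?_; _<?_)
open import Data.Nat.Properties
open import Data.Nat.Tactic.RingSolver using (solve-∀)
import Data.Nat.ListAction as ListAction
open import Algebra.Properties.Semiring.Sum +-*-semiring
  using (sum-syntax; sum-cong-≗; ∑-distrib-+; ∑-comm; *-distribˡ-sum; *-distribʳ-sum)
open import Data.Fin using (Fin; zero; suc)
open import Data.Fin.Properties using () renaming (_≟_ to _≟ᶠ_)
open import Data.Bool using (Bool; true; false; _∧_; not)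
import Data.List as List
open import Data.List.Properties using (map-tabulate)
open import Data.Product using (∃; ∃-syntax; _×_; _,_; swap)
open import Data.Sum using (_⊎_; inj₁; inj₂; map₂; [_,_]′)
open import Data.Empty using (⊥-elim)
open import Relation.Nullary using (¬_; yes; no)
open import Relation.Nullary.Decidable using (does)
open import Relation.Binary.PropositionalEquality
  using (_≡_; _≢_; refl; sym; trans; cong; cong₂; subst; subst₂; ≢-sym)
open import Function using (id; _∘_)

open ≤-Reasoning

∑-const : ∀ n m → ∑[ i < n ] m ≡ n * m
∑-const zero    m = refl
∑-const (suc n) m = cong (m +_) (∑-const n m)

∑-mono-≤ : ∀ {n} {f g : Fin n → ℕ} → (∀ i → f i ≤ g i) → ∑[ i < n ] f i ≤ ∑[ i < n ] g i
∑-mono-≤ {zero}  f≤g = z≤n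
∑-mono-≤ {suc n} f≤g = +-mono-≤ (f≤g zero) (∑-mono-≤ (f≤g ∘ suc))

sum-tabulate : ∀ n (f : Fin n → ℕ) → ListAction.sum (List.tabulate f) ≡ ∑[ i < n ] f i
sum-tabulate zero    f = refl
sum-tabulate (suc n) f = cong (f zero +_) (sum-tabulate n (f ∘ suc))

sum-map-allFin : ∀ n (f : Fin n → ℕ) → ListAction.sum (List.map f (List.allFin n)) ≡ ∑[ i < n ] f i
sum-map-allFin n f = trans (cong ListAction.sum (map-tabulate id f)) (sum-tabulate n f)

2mn≤m²+n² : ∀ m n → 2 * (m * n) ≤ m * m + n * n
2mn≤m²+n² zero    n       = z≤n
2mn≤m²+n² (suc m) zero    = ≤-trans (≤-reflexive (cong (2 *_) (*-zeroʳ (suc m)))) z≤n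
2mn≤m²+n² (suc m) (suc n) = begin
  2 * (suc m * suc n)                       ≡⟨ expandˡ m n ⟩
  2 * (m * n) + (2 * m + 2 * n + 2)         ≤⟨ +-monoˡ-≤ (2 * m + 2 * n + 2) (2mn≤m²+n² m n) ⟩
  m * m + n * n + (2 * m + 2 * n + 2)       ≡⟨ expandʳ m n ⟩
  suc m * suc m + suc n * suc n             ∎
  where
  expandˡ : ∀ m n → 2 * (suc m * suc n) ≡ 2 * (m * n) + (2 * m + 2 * n + 2)
  expandˡ = solve-∀
  expandʳ : ∀ m n → m * m + n * n + (2 * m + 2 * n + 2) ≡ suc m * suc m + suc n * suc n
  expandʳ = solve-∀

∑-square-≤ : ∀ {n} (f : Fin n → ℕ) → (∑[ i < n ] f i) * (∑[ i < n ] f i) ≤ n * ∑[ i < n ] (f i * f i)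
∑-square-≤ {n} f = *-cancelˡ-≤ 2 (begin
  2 * (S * S)                                           ≡⟨ cong (2 *_) square-expand ⟩
  2 * ∑[ i < n ] ∑[ j < n ] (f i * f j)                 ≡⟨ two-inside ⟩
  ∑[ i < n ] ∑[ j < n ] (2 * (f i * f j))               ≤⟨ ∑-mono-≤ (λ i → ∑-mono-≤ (λ j → 2mn≤m²+n² (f i) (f j))) ⟩
  ∑[ i < n ] ∑[ j < n ] (f i * f i + f j * f j)         ≡⟨ sum-cong-≗ (λ i → ∑-distrib-+ (λ _ → f i * f i) (λ j → f j * f j)) ⟩
  ∑[ i < n ] (∑[ j < n ] (f i * f i) + Q)               ≡⟨ ∑-distrib-+ (λ i → ∑[ j < n ] (f i * f i)) (λ _ → Q) ⟩
  ∑[ i < n ] ∑[ j < n ] (f i * f i) + ∑[ i < n ] Q      ≡⟨ cong₂ _+_ (sum-cong-≗ (λ i → ∑-const n (f i * f i))) (∑-const n Q) ⟩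
  ∑[ i < n ] (n * (f i * f i)) + n * Q                  ≡⟨ cong (_+ n * Q) (*-distribˡ-sum n (λ i → f i * f i)) ⟨
  n * Q + n * Q                                         ≡⟨ cong (n * Q +_) (+-identityʳ (n * Q)) ⟨
  2 * (n * Q)                                           ∎)
  where
  S = ∑[ i < n ] f i
  Q = ∑[ i < n ] (f i * f i)
  square-expand : S * S ≡ ∑[ i < n ] ∑[ j < n ] (f i * f j)
  square-expand = trans (*-distribʳ-sum S f) (sum-cong-≗ (λ i → *-distribˡ-sum (f i) f))
  two-inside : 2 * ∑[ i < n ] ∑[ j < n ] (f i * f j) ≡ ∑[ i < n ] ∑[ j < n ] (2 * (f i * f j))
  two-inside = trans (*-distribˡ-sum 2 (λ i → ∑[ j < n ] (f i * f j)))
                     (sum-cong-≗ (λ i → *-distribˡ-sum 2 (λ j → f i * f j)))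

3*m≡m+m+m : ∀ m → 3 * m ≡ m + m + m
3*m≡m+m+m = solve-∀

*-cancel-square : ∀ m k → m * m ≤ m * k → m ≤ k
*-cancel-square zero    k _  = z≤n
*-cancel-square (suc m) k le = *-cancelˡ-≤ (suc m) le

⊎-∀ : ∀ {k} {A : Set} {B : Fin k → Set} → (∀ i → A ⊎ B i) → A ⊎ (∀ i → B i)
⊎-∀ {zero}  f = inj₂ λ ()
⊎-∀ {suc k} f with f zero | ⊎-∀ (f ∘ suc)
... | inj₁ a  | _       = inj₁ a
... | inj₂ _  | inj₁ a  = inj₁ a
... | inj₂ b₀ | inj₂ bs = inj₂ λ { zero → b₀ ; (suc i) → bs i }

∣_∣ : ∀ {c} → (Fin c → Bool) → ℕ
∣_∣ {c} P = ∑[ i < c ] count (P i)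

count≤1 : ∀ b → count b ≤ 1
count≤1 true  = ≤-refl
count≤1 false = z≤n

∣P∣≤c : ∀ {c} (P : Fin c → Bool) → ∣ P ∣ ≤ c
∣P∣≤c {c} P = ≤-trans (∑-mono-≤ (count≤1 ∘ P)) (≤-reflexive (trans (∑-const c 1) (*-identityʳ c)))

∃-member : ∀ {c} (P : Fin c → Bool) → 1 ≤ ∣ P ∣ → ∃ λ i → P i ≡ true
∃-member {suc c} P nonempty with P zero in P₀
... | true  = zero , P₀
... | false with ∃-member (P ∘ suc) nonempty
...   | i , Pi = suc i , Pi

_-_ : ∀ {c} → (Fin c → Bool) → Fin c → (Fin c → Bool)
(P - j) i = not (does (i ≟ᶠ j)) ∧ P i

∣P∣≤1+∣P-j∣ : ∀ {c} (P : Fin c → Bool) j → ∣ P ∣ ≤ suc ∣ P - j ∣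
∣P∣≤1+∣P-j∣ P zero    = +-monoˡ-≤ ∣ P ∘ suc ∣ (count≤1 (P zero))
∣P∣≤1+∣P-j∣ P (suc j) = ≤-trans (+-monoʳ-≤ (count (P zero)) (∣P∣≤1+∣P-j∣ (P ∘ suc) j))
                                (≤-reflexive (+-suc (count (P zero)) ∣ (P ∘ suc) - j ∣))

∈-minus : ∀ {c} (P : Fin c → Bool) j i → (P - j) i ≡ true → P i ≡ true × i ≢ j
∈-minus P j i Pi with i ≟ᶠ j
∈-minus P j i () | yes _
∈-minus P j i Pi | no i≢j = Pi , i≢j

∃-member-≢ : ∀ {c} (P : Fin c → Bool) j → 2 ≤ ∣ P ∣ → ∃ λ i → P i ≡ true × i ≢ j
∃-member-≢ P j 2≤∣P∣ with ∃-member (P - j) (≤-pred (≤-trans 2≤∣P∣ (∣P∣≤1+∣P-j∣ P j)))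
... | i , i∈P-j = i , ∈-minus P j i i∈P-j

∃-member-≢₂ : ∀ {c} (P : Fin c → Bool) j k → 3 ≤ ∣ P ∣ → ∃ λ i → P i ≡ true × i ≢ j × i ≢ k
∃-member-≢₂ P j k 3≤∣P∣ with ∃-member-≢ (P - j) k (≤-pred (≤-trans 3≤∣P∣ (∣P∣≤1+∣P-j∣ P j)))
... | i , i∈P-j , i≢k with ∈-minus P j i i∈P-j
...   | Pi , i≢j = i , Pi , i≢j , i≢k

SDR : ∀ {c} → (Fin c → Bool) → (Fin c → Bool) → (Fin c → Bool) → Set
SDR X Y Z = ∃[ x ] ∃[ y ] ∃[ z ] (X x ≡ true × Y y ≡ true × Z z ≡ true × x ≢ y × y ≢ z × x ≢ z)

module _ {c : ℕ} {X Y Z : Fin c → Bool} where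

  SDR-swap₁₂ : SDR X Y Z → SDR Y X Z
  SDR-swap₁₂ (x , y , z , x∈ , y∈ , z∈ , x≢y , y≢z , x≢z) = y , x , z , y∈ , x∈ , z∈ , ≢-sym x≢y , x≢z , y≢z

  SDR-swap₂₃ : SDR X Y Z → SDR X Z Y
  SDR-swap₂₃ (x , y , z , x∈ , y∈ , z∈ , x≢y , y≢z , x≢z) = x , z , y , x∈ , z∈ , y∈ , x≢z , ≢-sym y≢z , x≢y

  sdr-greedy : 1 ≤ ∣ X ∣ → 2 ≤ ∣ Y ∣ → 3 ≤ ∣ Z ∣ → SDR X Y Z
  sdr-greedy 1≤∣X∣ 2≤∣Y∣ 3≤∣Z∣ with ∃-member X 1≤∣X∣
  ... | x , x∈ with ∃-member-≢ Y x 2≤∣Y∣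
  ...   | y , y∈ , y≢x with ∃-member-≢₂ Z x y 3≤∣Z∣
  ...     | z , z∈ , z≢x , z≢y = x , y , z , x∈ , y∈ , z∈ , ≢-sym y≢x , ≢-sym z≢y , ≢-sym z≢x

module _ {c : ℕ} {E : Fin c → Bool} where

  -- Since c ≥ 4, the larger of two sets with |S| + |T| > c has at least 3 elements.
  sdr-heavy-pair-≤ : ∀ (S T : Fin c → Bool) → 4 ≤ c → ∣ S ∣ ≤ ∣ T ∣ → c < ∣ S ∣ + ∣ T ∣ → 1 ≤ ∣ E ∣ →
                     2 ≤ ∣ E ∣ ⊎ (2 ≤ ∣ S ∣ × 2 ≤ ∣ T ∣) → SDR S T E
  sdr-heavy-pair-≤ S T c≥4 S≤T heavy 1≤∣E∣ = [ E-rich , S-rich ]′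
    where
    1≤∣S∣ : 1 ≤ ∣ S ∣
    1≤∣S∣ = n≢0⇒n>0 λ S≡0 → <⇒≱ heavy (≤-trans (≤-reflexive (cong (_+ ∣ T ∣) S≡0)) (∣P∣≤c T))
    3≤∣T∣ : 3 ≤ ∣ T ∣
    3≤∣T∣ = ≮⇒≥ λ T<3 → <⇒≱ heavy (≤-trans (+-mono-≤ (≤-trans S≤T (≤-pred T<3)) (≤-pred T<3)) c≥4)
    E-rich : 2 ≤ ∣ E ∣ → SDR S T E
    E-rich 2≤∣E∣ = SDR-swap₂₃ (sdr-greedy 1≤∣S∣ 2≤∣E∣ 3≤∣T∣)
    S-rich : 2 ≤ ∣ S ∣ × 2 ≤ ∣ T ∣ → SDR S T E
    S-rich (2≤∣S∣ , _) = SDR-swap₂₃ (SDR-swap₁₂ (sdr-greedy 1≤∣E∣ 2≤∣S∣ 3≤∣T∣))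

  sdr-heavy-pair : ∀ {S T : Fin c → Bool} → 4 ≤ c → c < ∣ S ∣ + ∣ T ∣ → 1 ≤ ∣ E ∣ →
                   2 ≤ ∣ E ∣ ⊎ (2 ≤ ∣ S ∣ × 2 ≤ ∣ T ∣) → SDR S T E
  sdr-heavy-pair {S} {T} c≥4 heavy 1≤∣E∣ rich with ≤-total ∣ S ∣ ∣ T ∣
  ... | inj₁ S≤T = sdr-heavy-pair-≤ S T c≥4 S≤T heavy 1≤∣E∣ rich
  ... | inj₂ T≤S = SDR-swap₁₂ (sdr-heavy-pair-≤ T S c≥4 T≤S (subst (c <_) (+-comm ∣ S ∣ ∣ T ∣) heavy) 1≤∣E∣ (map₂ swap rich))

≱2⇒≤1 : ∀ {m} → ¬ 2 ≤ m → m ≤ 1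
≱2⇒≤1 = ≤-pred ∘ ≰⇒>

heavy-star : ∀ {c} {S T E₁ E₂ : Fin c → Bool} → 4 ≤ c → c < ∣ S ∣ + ∣ T ∣ → 1 ≤ ∣ E₁ ∣ + ∣ E₂ ∣ →
             SDR S T E₁ ⊎ SDR S T E₂ ⊎ (∣ S ∣ + ∣ T ∣ ≤ suc c × ∣ E₁ ∣ + ∣ E₂ ∣ ≤ 2)
heavy-star {c} {S} {T} {E₁} {E₂} c≥4 heavy 1≤∣E∣ with 2 ≤? ∣ E₁ ∣ | 2 ≤? ∣ E₂ ∣
... | yes 2≤∣E₁∣ | _        = inj₁ (sdr-heavy-pair c≥4 heavy (<⇒≤ 2≤∣E₁∣) (inj₁ 2≤∣E₁∣))
... | no _      | yes 2≤∣E₂∣ = inj₂ (inj₁ (sdr-heavy-pair c≥4 heavy (<⇒≤ 2≤∣E₂∣) (inj₁ 2≤∣E₂∣)))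
... | no ∣E₁∣≱2 | no ∣E₂∣≱2 with 2 ≤? ∣ S ∣ | 2 ≤? ∣ T ∣
...   | no ∣S∣≱2 | _ =
        inj₂ (inj₂ (+-mono-≤ (≱2⇒≤1 ∣S∣≱2) (∣P∣≤c T) , +-mono-≤ (≱2⇒≤1 ∣E₁∣≱2) (≱2⇒≤1 ∣E₂∣≱2)))
...   | yes _ | no ∣T∣≱2 =
        inj₂ (inj₂ (≤-trans (+-mono-≤ (∣P∣≤c S) (≱2⇒≤1 ∣T∣≱2)) (≤-reflexive (+-comm c 1))
                   , +-mono-≤ (≱2⇒≤1 ∣E₁∣≱2) (≱2⇒≤1 ∣E₂∣≱2)))
...   | yes 2≤∣S∣ | yes 2≤∣T∣ with 1 ≤? ∣ E₁ ∣
...     | yes 1≤∣E₁∣ = inj₁ (sdr-heavy-pair c≥4 heavy 1≤∣E₁∣ (inj₂ (2≤∣S∣ , 2≤∣T∣)))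
...     | no ∣E₁∣≱1  = inj₂ (inj₁ (sdr-heavy-pair c≥4 heavy 1≤∣E₂∣ (inj₂ (2≤∣S∣ , 2≤∣T∣))))
  where
  1≤∣E₂∣ : 1 ≤ ∣ E₂ ∣
  1≤∣E₂∣ = subst (λ k → 1 ≤ k + ∣ E₂ ∣) (n≤0⇒n≡0 (≤-pred (≰⇒> ∣E₁∣≱1))) 1≤∣E∣

TriangleBound : ℕ → ℕ → ℕ → ℕ → Set
TriangleBound c a b d = a * b + a * d + b * d ≤ c * (a + b + d)

TriangleBound-swap₁₂ : ∀ c a b d → TriangleBound c a b d → TriangleBound c b a d
TriangleBound-swap₁₂ c a b d = subst₂ _≤_ (lhs a b d) (rhs c a b d)
  where
  lhs : ∀ a b d → a * b + a * d + b * d ≡ b * a + b * d + a * d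
  lhs = solve-∀
  rhs : ∀ c a b d → c * (a + b + d) ≡ c * (b + a + d)
  rhs = solve-∀

TriangleBound-swap₂₃ : ∀ c a b d → TriangleBound c a b d → TriangleBound c a d b
TriangleBound-swap₂₃ c a b d = subst₂ _≤_ (lhs a b d) (rhs c a b d)
  where
  lhs : ∀ a b d → a * b + a * d + b * d ≡ a * d + a * b + d * b
  lhs = solve-∀
  rhs : ∀ c a b d → c * (a + b + d) ≡ c * (a + d + b)
  rhs = solve-∀

-- 3(ab + ad + bd) ≤ (a + b + d)² ≤ 3c(a + b + d).
TriangleBound-light : ∀ c a b d → a + b + d ≤ 3 * c → TriangleBound c a b d
TriangleBound-light c a b d light = *-cancelˡ-≤ 6 (begin
  6 * P                                                         ≡⟨ split a b d ⟩
  2 * (a * b) + 2 * (a * d) + 2 * (b * d) + 4 * P               ≤⟨ +-monoˡ-≤ (4 * P) squares ⟩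
  (a * a + b * b) + (a * a + d * d) + (b * b + d * d) + 4 * P   ≡⟨ complete a b d ⟩
  2 * (s * s)                                                   ≤⟨ *-monoʳ-≤ 2 (*-monoˡ-≤ s light) ⟩
  2 * (3 * c * s)                                               ≡⟨ regroup c s ⟩
  6 * (c * s)                                                   ∎)
  where
  P = a * b + a * d + b * d
  s = a + b + d
  squares = +-mono-≤ (+-mono-≤ (2mn≤m²+n² a b) (2mn≤m²+n² a d)) (2mn≤m²+n² b d)
  split : ∀ a b d → 6 * (a * b + a * d + b * d) ≡ 2 * (a * b) + 2 * (a * d) + 2 * (b * d) + 4 * (a * b + a * d + b * d)
  split = solve-∀
  complete : ∀ a b d → (a * a + b * b) + (a * a + d * d) + (b * b + d * d) + 4 * (a * b + a * d + b * d)
                     ≡ 2 * ((a + b + d) * (a + b + d))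
  complete = solve-∀
  regroup : ∀ c s → 2 * (3 * c * s) ≡ 6 * (c * s)
  regroup = solve-∀

mn≤c[m+n] : ∀ c {m n} → m ≤ n → n ≤ 2 * c → m * n ≤ c * (m + n)
mn≤c[m+n] c {m} {n} m≤n n≤2c = begin
  m * n        ≤⟨ *-monoʳ-≤ m n≤2c ⟩
  m * (2 * c)  ≡⟨ regroup m c ⟩
  c * (m + m)  ≤⟨ *-monoʳ-≤ c (+-monoʳ-≤ m m≤n) ⟩
  c * (m + n)  ∎
  where
  regroup : ∀ m c → m * (2 * c) ≡ c * (m + m)
  regroup = solve-∀

TriangleBound-empty-side : ∀ c {b d} → b ≤ 2 * c → d ≤ 2 * c → TriangleBound c 0 b d
TriangleBound-empty-side c {b} {d} b≤2c d≤2c with ≤-total b d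
... | inj₁ b≤d = mn≤c[m+n] c b≤d d≤2c
... | inj₂ d≤b = subst₂ _≤_ (*-comm d b) (cong (c *_) (+-comm d b)) (mn≤c[m+n] c d≤b b≤2c)

module SymmetricWeights {n : ℕ} (W : Fin n → Fin n → ℕ) (W-sym : ∀ x y → W x y ≡ W y x) where

  degree : Fin n → ℕ
  degree x = ∑[ y < n ] W x y

  total : ℕ
  total = ∑[ x < n ] degree x

  private
    Q : ℕ
    Q = ∑[ x < n ] (degree x * degree x)

    ∑³ : (Fin n → Fin n → Fin n → ℕ) → ℕ
    ∑³ F = ∑[ x < n ] ∑[ y < n ] ∑[ z < n ] F x y z

    ∑³-distrib-+ : ∀ F H → ∑³ (λ x y z → F x y z + H x y z) ≡ ∑³ F + ∑³ H
    ∑³-distrib-+ F H =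
      trans (sum-cong-≗ λ x → trans (sum-cong-≗ λ y → ∑-distrib-+ (F x y) (H x y))
                                    (∑-distrib-+ (λ y → ∑[ z < n ] F x y z) (λ y → ∑[ z < n ] H x y z)))
            (∑-distrib-+ (λ x → ∑[ y < n ] ∑[ z < n ] F x y z) (λ x → ∑[ y < n ] ∑[ z < n ] H x y z))

    ∑³-distribˡ-* : ∀ m F → m * ∑³ F ≡ ∑³ (λ x y z → m * F x y z)
    ∑³-distribˡ-* m F =
      trans (*-distribˡ-sum m (λ x → ∑[ y < n ] ∑[ z < n ] F x y z))
            (sum-cong-≗ λ x → trans (*-distribˡ-sum m (λ y → ∑[ z < n ] F x y z))
                                    (sum-cong-≗ λ y → *-distribˡ-sum m (F x y)))

    ∑³-mono-≤ : ∀ {F H} → (∀ x y z → F x y z ≤ H x y z) → ∑³ F ≤ ∑³ H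
    ∑³-mono-≤ F≤H = ∑-mono-≤ λ x → ∑-mono-≤ λ y → ∑-mono-≤ λ z → F≤H x y z

    cherries : ∑³ (λ x y z → W x y * W x z) ≡ Q
    cherries = sum-cong-≗ λ x → trans (sum-cong-≗ λ y → sym (*-distribˡ-sum (W x y) (W x)))
                                       (sym (*-distribʳ-sum (degree x) (W x)))

    cherries-middle : ∑³ (λ x y z → W x y * W y z) ≡ Q
    cherries-middle = trans (∑-comm (λ x y → ∑[ z < n ] (W x y * W y z)))
      (trans (sum-cong-≗ λ y → sum-cong-≗ λ x → sum-cong-≗ λ z → cong (_* W y z) (W-sym x y)) cherries)

    cherries-last : ∑³ (λ x y z → W x z * W y z) ≡ Q
    cherries-last = trans (sum-cong-≗ λ x → ∑-comm (λ y z → W x z * W y z))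
      (trans (∑-comm (λ x z → ∑[ y < n ] (W x z * W y z)))
        (trans (sum-cong-≗ λ z → sum-cong-≗ λ x → sum-cong-≗ λ y → cong₂ _*_ (W-sym x z) (W-sym y z)) cherries))

    ∑³-first : ∑³ (λ x y z → W x y) ≡ n * total
    ∑³-first = trans (sum-cong-≗ λ x → trans (sum-cong-≗ λ y → ∑-const n (W x y)) (sym (*-distribˡ-sum n (W x))))
                     (sym (*-distribˡ-sum n degree))

    ∑³-second : ∑³ (λ x y z → W x z) ≡ n * total
    ∑³-second = trans (sum-cong-≗ λ x → ∑-const n (degree x)) (sym (*-distribˡ-sum n degree))

    ∑³-third : ∑³ (λ x y z → W y z) ≡ n * total
    ∑³-third = ∑-const n total

    ∑³-distrib-+₃ : ∀ F G H → ∑³ (λ x y z → F x y z + G x y z + H x y z) ≡ ∑³ F + ∑³ G + ∑³ H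
    ∑³-distrib-+₃ F G H = trans (∑³-distrib-+ (λ x y z → F x y z + G x y z) H) (cong (_+ ∑³ H) (∑³-distrib-+ F G))

    ∑³-products : ∑³ (λ x y z → W x y * W x z + W x y * W y z + W x z * W y z) ≡ 3 * Q
    ∑³-products = begin-equality
      ∑³ (λ x y z → W x y * W x z + W x y * W y z + W x z * W y z)  ≡⟨ ∑³-distrib-+₃ _ _ _ ⟩
      ∑³ (λ x y z → W x y * W x z) + ∑³ (λ x y z → W x y * W y z)
        + ∑³ (λ x y z → W x z * W y z)                               ≡⟨ cong₂ _+_ (cong₂ _+_ cherries cherries-middle) cherries-last ⟩
      Q + Q + Q                                                      ≡⟨ 3*m≡m+m+m Q ⟨
      3 * Q                                                          ∎

    ∑³-sides : ∑³ (λ x y z → W x y + W x z + W y z) ≡ 3 * (n * total)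
    ∑³-sides = trans (∑³-distrib-+₃ _ _ _) (trans (cong₂ _+_ (cong₂ _+_ ∑³-first ∑³-second) ∑³-third)
                                                  (sym (3*m≡m+m+m (n * total))))

    Q≤cnT : ∀ c → (∀ x y z → TriangleBound c (W x y) (W x z) (W y z)) → Q ≤ c * (n * total)
    Q≤cnT c bound = *-cancelˡ-≤ 3 (begin
      3 * Q                                                          ≡⟨ ∑³-products ⟨
      ∑³ (λ x y z → W x y * W x z + W x y * W y z + W x z * W y z)  ≤⟨ ∑³-mono-≤ bound ⟩
      ∑³ (λ x y z → c * (W x y + W x z + W y z))                    ≡⟨ ∑³-distribˡ-* c (λ x y z → W x y + W x z + W y z) ⟨
      c * ∑³ (λ x y z → W x y + W x z + W y z)                      ≡⟨ cong (c *_) ∑³-sides ⟩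
      c * (3 * (n * total))                                          ≡⟨ *-comm-middle c 3 (n * total) ⟩
      3 * (c * (n * total))                                          ∎)
      where
      *-comm-middle : ∀ a b m → a * (b * m) ≡ b * (a * m)
      *-comm-middle = solve-∀

  total≤cn² : ∀ c → (∀ x y z → TriangleBound c (W x y) (W x z) (W y z)) → total ≤ c * (n * n)
  total≤cn² c bound = *-cancel-square total (c * (n * n)) (begin
    total * total               ≤⟨ ∑-square-≤ degree ⟩
    n * Q                       ≤⟨ *-monoʳ-≤ n (Q≤cnT c bound) ⟩
    n * (c * (n * total))       ≡⟨ regroup n c total ⟩
    total * (c * (n * n))       ∎)
    where
    regroup : ∀ n c t → n * (c * (n * t)) ≡ t * (c * (n * n))
    regroup = solve-∀

module Colouring {c n : ℕ} (G : Fin c → Digraph n) where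

  colours : Fin n → Fin n → Fin c → Bool
  colours u v i = adj (G i) u v

  W : Fin n → Fin n → ℕ
  W u v = ∣ colours u v ∣ + ∣ colours v u ∣

  W-sym : ∀ u v → W u v ≡ W v u
  W-sym u v = +-comm ∣ colours u v ∣ ∣ colours v u ∣

  W≤2c : ∀ u v → W u v ≤ 2 * c
  W≤2c u v = ≤-trans (+-mono-≤ (∣P∣≤c (colours u v)) (∣P∣≤c (colours v u)))
                     (≤-reflexive (cong (c +_) (sym (+-identityʳ c))))

  ∣colours-u-u∣≡0 : ∀ u → ∣ colours u u ∣ ≡ 0
  ∣colours-u-u∣≡0 u = trans (sum-cong-≗ λ i → cong count (loopless (G i) u)) (trans (∑-const c 0) (*-zeroʳ c))

  1≤W⇒≢ : ∀ {u v} → 1 ≤ W u v → u ≢ v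
  1≤W⇒≢ {u} 1≤W refl = <⇒≱ 1≤W (≤-reflexive (cong₂ _+_ (∣colours-u-u∣≡0 u) (∣colours-u-u∣≡0 u)))

  1≤W-sym : ∀ {u v} → 1 ≤ W u v → 1 ≤ W v u
  1≤W-sym {u} {v} = subst (1 ≤_) (W-sym u v)

  rainbow : ∀ {u v w} → 1 ≤ W u v → 1 ≤ W v w → 1 ≤ W u w →
            SDR (colours u v) (colours v w) (colours u w) → RainbowTransitiveTriangle G
  rainbow {u} {v} {w} uv vw uw (a , b , d , a∈ , b∈ , d∈ , a≢b , b≢d , a≢d) =
    u , v , w , a , b , d , 1≤W⇒≢ uv , 1≤W⇒≢ vw , 1≤W⇒≢ uw , a≢b , b≢d , a≢d , a∈ , b∈ , d∈

  out : Fin n → Fin n → Fin n → ℕ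
  out x y z = ∣ colours x y ∣ + ∣ colours x z ∣

  into : Fin n → Fin n → Fin n → ℕ
  into x y z = ∣ colours y x ∣ + ∣ colours z x ∣

  sides : Fin n → Fin n → Fin n → ℕ
  sides x y z = W x y + W x z + W y z

  sides-swap₁₂ : ∀ x y z → sides y x z ≡ sides x y z
  sides-swap₁₂ x y z = trans (cong (λ a → a + W y z + W x z) (W-sym y x)) (+-swap-last (W x y) (W x z) (W y z))
    where
    +-swap-last : ∀ a b d → a + d + b ≡ a + b + d
    +-swap-last = solve-∀

  sides-rotate : ∀ x y z → sides z x y ≡ sides x y z
  sides-rotate x y z = trans (cong₂ (λ b d → b + d + W x y) (W-sym z x) (W-sym z y)) (+-rotate (W x y) (W x z) (W y z))
    where
    +-rotate : ∀ a b d → b + d + a ≡ a + b + d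
    +-rotate = solve-∀

  out-star : ∀ {x y z} → 4 ≤ c → 1 ≤ W x y → 1 ≤ W x z → 1 ≤ W y z → c < out x y z →
             RainbowTransitiveTriangle G ⊎ (out x y z ≤ suc c × W y z ≤ 2)
  out-star c≥4 xy xz yz heavy with heavy-star c≥4 heavy yz
  ... | inj₁ xyz           = inj₁ (rainbow xy yz xz (SDR-swap₂₃ xyz))
  ... | inj₂ (inj₁ xzy)    = inj₁ (rainbow xz (1≤W-sym yz) xy (SDR-swap₂₃ (SDR-swap₁₂ xzy)))
  ... | inj₂ (inj₂ bounds) = inj₂ bounds

  in-star : ∀ {x y z} → 4 ≤ c → 1 ≤ W x y → 1 ≤ W x z → 1 ≤ W y z →
            RainbowTransitiveTriangle G ⊎ into x y z ≤ suc c
  in-star {x} {y} {z} c≥4 xy xz yz with c <? into x y z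
  ... | no light = inj₂ (m≤n⇒m≤1+n (≮⇒≥ light))
  ... | yes heavy with heavy-star c≥4 heavy yz
  ...   | inj₁ yzx                = inj₁ (rainbow yz (1≤W-sym xz) (1≤W-sym xy) (SDR-swap₁₂ (SDR-swap₂₃ (SDR-swap₁₂ yzx))))
  ...   | inj₂ (inj₁ zyx)         = inj₁ (rainbow (1≤W-sym yz) (1≤W-sym xy) (1≤W-sym xz) (SDR-swap₁₂ (SDR-swap₂₃ zyx)))
  ...   | inj₂ (inj₂ (bound , _)) = inj₂ bound

  -- The heavy out-star at x leaves at most 2 colours on yz, and both stars at x carry at most c + 1.
  heavy-vertex : ∀ {x y z} → 4 ≤ c → 1 ≤ W x y → 1 ≤ W x z → 1 ≤ W y z → c < out x y z →
                 RainbowTransitiveTriangle G ⊎ sides x y z ≤ 3 * c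
  heavy-vertex {x} {y} {z} c≥4 xy xz yz heavy with out-star c≥4 xy xz yz heavy | in-star c≥4 xy xz yz
  ... | inj₁ rainbow-xyz   | _                = inj₁ rainbow-xyz
  ... | inj₂ _             | inj₁ rainbow-xyz = inj₁ rainbow-xyz
  ... | inj₂ (out≤ , yz≤2) | inj₂ into≤       = inj₂ (begin
    sides x y z                     ≡⟨ regroup (∣ colours x y ∣) (∣ colours y x ∣) (∣ colours x z ∣) (∣ colours z x ∣) (W y z) ⟩
    out x y z + into x y z + W y z  ≤⟨ +-mono-≤ (+-mono-≤ out≤ into≤) yz≤2 ⟩
    suc c + suc c + 2               ≡⟨ expand c ⟩
    4 + 2 * c                       ≤⟨ +-monoˡ-≤ (2 * c) c≥4 ⟩
    3 * c                           ∎)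
    where
    regroup : ∀ a a' b b' d → (a + a') + (b + b') + d ≡ (a + b) + (a' + b') + d
    regroup = solve-∀
    expand : ∀ c → suc c + suc c + 2 ≡ 4 + 2 * c
    expand = solve-∀

  rainbow-or-light : ∀ {x y z} → 4 ≤ c → 1 ≤ W x y → 1 ≤ W x z → 1 ≤ W y z →
                     RainbowTransitiveTriangle G ⊎ sides x y z ≤ 3 * c
  rainbow-or-light {x} {y} {z} c≥4 xy xz yz with c <? out x y z | c <? out y x z | c <? out z x y
  ... | yes heavy | _ | _ = heavy-vertex c≥4 xy xz yz heavy
  ... | no _ | yes heavy | _ =
        map₂ (subst (_≤ 3 * c) (sides-swap₁₂ x y z)) (heavy-vertex c≥4 (1≤W-sym xy) yz xz heavy)
  ... | no _ | no _ | yes heavy =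
        map₂ (subst (_≤ 3 * c) (sides-rotate x y z)) (heavy-vertex c≥4 (1≤W-sym xz) (1≤W-sym yz) xy heavy)
  ... | no light-x | no light-y | no light-z = inj₂ (begin
    sides x y z                        ≡⟨ by-vertex (∣ colours x y ∣) (∣ colours y x ∣) (∣ colours x z ∣)
                                                    (∣ colours z x ∣) (∣ colours y z ∣) (∣ colours z y ∣) ⟩
    out x y z + out y x z + out z x y  ≤⟨ +-mono-≤ (+-mono-≤ (≮⇒≥ light-x) (≮⇒≥ light-y)) (≮⇒≥ light-z) ⟩
    c + c + c                          ≡⟨ 3*m≡m+m+m c ⟨
    3 * c                              ∎)
    where
    by-vertex : ∀ a a' b b' d d' → (a + a') + (b + b') + (d + d') ≡ (a + b) + (a' + d) + (b' + d')
    by-vertex = solve-∀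

  rainbow-or-TriangleBound : 4 ≤ c → ∀ x y z → RainbowTransitiveTriangle G ⊎ TriangleBound c (W x y) (W x z) (W y z)
  rainbow-or-TriangleBound c≥4 x y z with W x y ≟ 0 | W x z ≟ 0 | W y z ≟ 0
  ... | yes xy≡0 | _ | _ =
        inj₂ (subst (λ a → TriangleBound c a (W x z) (W y z)) (sym xy≡0)
               (TriangleBound-empty-side c (W≤2c x z) (W≤2c y z)))
  ... | no _ | yes xz≡0 | _ =
        inj₂ (subst (λ b → TriangleBound c (W x y) b (W y z)) (sym xz≡0)
               (TriangleBound-swap₁₂ c 0 (W x y) (W y z) (TriangleBound-empty-side c (W≤2c x y) (W≤2c y z))))
  ... | no _ | no _ | yes yz≡0 =
        inj₂ (subst (TriangleBound c (W x y) (W x z)) (sym yz≡0)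
               (TriangleBound-swap₂₃ c (W x y) 0 (W x z) (TriangleBound-swap₁₂ c 0 (W x y) (W x z)
                 (TriangleBound-empty-side c (W≤2c x y) (W≤2c x z)))))
  ... | no xy≢0 | no xz≢0 | no yz≢0 =
        map₂ (TriangleBound-light c (W x y) (W x z) (W y z))
             (rainbow-or-light c≥4 (n≢0⇒n>0 xy≢0) (n≢0⇒n>0 xz≢0) (n≢0⇒n>0 yz≢0))

  open SymmetricWeights W W-sym public using (total; total≤cn²)

  rainbow-or-sparse : 4 ≤ c → RainbowTransitiveTriangle G ⊎ total ≤ c * (n * n)
  rainbow-or-sparse c≥4 = map₂ (total≤cn² c) (⊎-∀ λ x → ⊎-∀ λ y → ⊎-∀ λ z → rainbow-or-TriangleBound c≥4 x y z)

  edges : ℕ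
  edges = ∑[ x < n ] ∑[ y < n ] ∣ colours x y ∣

  edges≡∑e : edges ≡ sumFin c (λ i → e (G i))
  edges≡∑e = begin-equality
    ∑[ x < n ] ∑[ y < n ] ∑[ i < c ] count (adj (G i) x y)  ≡⟨ sum-cong-≗ (λ x → ∑-comm (λ y i → count (adj (G i) x y))) ⟩
    ∑[ x < n ] ∑[ i < c ] ∑[ y < n ] count (adj (G i) x y)  ≡⟨ ∑-comm (λ x i → ∑[ y < n ] count (adj (G i) x y)) ⟩
    ∑[ i < c ] ∑[ x < n ] ∑[ y < n ] count (adj (G i) x y)  ≡⟨ sum-cong-≗ (λ i → e≡∑∑ (G i)) ⟨
    ∑[ i < c ] e (G i)                                      ≡⟨ sum-map-allFin c (λ i → e (G i)) ⟨
    sumFin c (λ i → e (G i))                                ∎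
    where
    e≡∑∑ : ∀ H → e H ≡ ∑[ x < n ] ∑[ y < n ] count (adj H x y)
    e≡∑∑ H = trans (sum-map-allFin n _) (sum-cong-≗ λ x → sum-map-allFin n (λ y → count (adj H x y)))

  total≡2edges : total ≡ 2 * edges
  total≡2edges = begin-equality
    total                         ≡⟨ sum-cong-≗ (λ x → ∑-distrib-+ (λ y → ∣ colours x y ∣) (λ y → ∣ colours y x ∣)) ⟩
    ∑[ x < n ] (∑[ y < n ] ∣ colours x y ∣ + ∑[ y < n ] ∣ colours y x ∣)
                                  ≡⟨ ∑-distrib-+ (λ x → ∑[ y < n ] ∣ colours x y ∣) (λ x → ∑[ y < n ] ∣ colours y x ∣) ⟩
    edges + ∑[ x < n ] ∑[ y < n ] ∣ colours y x ∣
                                  ≡⟨ cong (edges +_) (∑-comm (λ x y → ∣ colours y x ∣)) ⟩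
    edges + edges                 ≡⟨ cong (edges +_) (+-identityʳ edges) ⟨
    2 * edges                     ∎

theorem7 : (c n : ℕ) → c ≥ 4 → (G : Fin c → Digraph n) →
           2 * sumFin c (λ i → e (G i)) > c * n ^ 2 →
           RainbowTransitiveTriangle G
theorem7 c n c≥4 G dense = [ id , ⊥-elim ∘ <⇒≱ dense ∘ bound ]′ (rainbow-or-sparse c≥4)
  where
  open Colouring G
  bound : total ≤ c * (n * n) → 2 * sumFin c (λ i → e (G i)) ≤ c * n ^ 2
  bound sparse = begin
    2 * sumFin c (λ i → e (G i))  ≡⟨ cong (2 *_) edges≡∑e ⟨
    2 * edges                     ≡⟨ total≡2edges ⟨
    total                         ≤⟨ sparse ⟩
    c * (n * n)                   ≡⟨ cong (λ m → c * (n * m)) (*-identityʳ n) ⟨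
    c * n ^ 2                     ∎
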